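{- Let $d\ge 2$ and $n\ge1$, let $P\in\Lambda_1(d,n)$ and let $H=\mathcal H(P)$. Let $T=\{\alpha_1,\dots,\alpha_n\}$ be a transversal of $H$. Then \[\sum_{i=1}^n \Delta(\alpha_i)\equiv\begin{cases}0 \pmod n&\text{if } n \text{ is odd or } d \text{ is even,}\\ n/2 \pmod n&\text{otherwise.}\end{cases}\]
   Context: Let $I_n=\{1,\dots,n\}$ and let $M(d,n)$ be the set of maps $I_n^d\to\mathbb R$ ($d$-dimensional matrices of order $n$). A line of $A\in M(d,n)$ is a set of $n$ positions obtained by fixing all coordinates but one. $\Lambda_1(d,n)$ is the set of $(0,1)$-matrices in $M(d,n)$ with exactly one $1$ in each line. For $P\in\Lambda_1(d,n)$, $\mathcal H(P)\in M(d-1,n)$ is the Latin hypercube of dimension $d-1$ with $\mathcal H(P)(i_1,\dots,i_{d-1})=i_d$ iff $P(i_1,\dots,i_d)=1$ (every line of it contains each symbol of $I_n$ exactly once). A transversal of a Latin hypercube $H\in M(d-1,n)$ is a set of $n$ of its entries (positions with their symbols) such that any two differ in every coordinate and carry different symbols. For an entry $e=H(i_1,\dots,i_{d-1})$ of $H$, the Delta function is $\Delta(e)\equiv e-i_1-\cdots-i_{d-1}\pmod n$. -}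

module Defs where

open import Data.Nat using (ℕ; zero; suc)
open import Data.Fin using (Fin; zero; suc; toℕ)
open import Data.Integer using (ℤ; +_; _+_; _-_)
open import Data.Vec.Functional using (Vector; updateAt; tail)
open import Data.Product using (Σ; _×_)
open import Data.Sum using (_⊎_)
open import Relation.Binary.PropositionalEquality using (_≡_; _≢_)

-- Positions of a d-dimensional matrix of order n; coordinates are Fin n,
-- with Fin value k standing for the paper's index k+1 ∈ I_n.
Pos : ℕ → ℕ → Set
Pos d n = Vector (Fin n) d

-- M(d,n) restricted to integer-valued entries (only (0,1)-matrices are needed)
Mat : ℕ → ℕ → Set
Mat d n = Pos d n → ℕ

-- the position obtained from x by replacing coordinate k by j;
-- as j ranges over Fin n this enumerates the line through x in direction k
setCoord : ∀ {d n} → Pos d n → Fin d → Fin n → Pos d n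
setCoord x k j = updateAt x k (λ _ → j)

IsZeroOne : ∀ {d n} → Mat d n → Set
IsZeroOne P = ∀ x → P x ≡ 0 ⊎ P x ≡ 1

ExactlyOneInEachLine : ∀ {d n} → Mat d n → Set
ExactlyOneInEachLine {d} {n} P =
  ∀ (x : Pos d n) (k : Fin d) →
    Σ (Fin n) λ j → P (setCoord x k j) ≡ 1 × (∀ j′ → P (setCoord x k j′) ≡ 1 → j′ ≡ j)

Λ₁ : ∀ d n → Mat d n → Set
Λ₁ d n P = IsZeroOne P × ExactlyOneInEachLine P

snoc : ∀ {m n} → Pos m n → Fin n → Pos (suc m) n
snoc {zero}  i s zero    = s
snoc {suc m} i s zero    = i zero
snoc {suc m} i s (suc k) = snoc (tail i) s k

IsH : ∀ {m n} → Mat (suc m) n → (Pos m n → Fin n) → Set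
IsH {m} {n} P H = ∀ (i : Pos m n) (s : Fin n) → (H i ≡ s → P (snoc i s) ≡ 1) × (P (snoc i s) ≡ 1 → H i ≡ s)

-- A transversal of H: n entries (given by their positions α a, a ∈ I_n, the symbol
-- being H (α a)) such that any two distinct ones differ in every coordinate and
-- carry different symbols.
IsTransversal : ∀ {m n} → (Pos m n → Fin n) → (Fin n → Pos m n) → Set
IsTransversal {m} {n} H α =
  ∀ (a b : Fin n) → a ≢ b → (∀ (k : Fin m) → α a k ≢ α b k) × (H (α a) ≢ H (α b))

-- paper's 1-based value of a Fin n
val : ∀ {n} → Fin n → ℤ
val j = + suc (toℕ j)

sumℤ : ∀ {k} → Vector ℤ k → ℤ
sumℤ {zero}  f = + 0
sumℤ {suc k} f = f zero + sumℤ (tail f)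

-- Δ(e) = e - i₁ - ⋯ - i_{d-1} as an integer (to be read mod n),
-- for the entry of H at position i
Δ : ∀ {m n} → (Pos m n → Fin n) → Pos m n → ℤ
Δ H i = val (H i) - sumℤ (λ k → val (i k))

-- Summed over a transversal, Δ is the sum of the symbols minus the sum of all
-- coordinates. The symbols, and the values of each of the m = d − 1 coordinates,
-- run through 1, …, n exactly once, so the sum is (1 − m)·T with 2T = n(n + 1).
-- If n is odd then n ∣ T; if d is even then 1 − m is even and (1 − m)·T is a
-- multiple of n(n + 1); if n = 2q and m = 2r then (1 − 2r)·T − q = n(q − r(n + 1)).
module Submission where

open import Defs
open import Data.Nat using (ℕ; suc; _≤_; _/_)
open import Data.Nat.Divisibility using () renaming (_∣_ to _∣ℕ_)
open import Data.Integer using (+_; _-_)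
open import Data.Integer.Divisibility using (_∣_)
open import Data.Product using (_×_)
open import Data.Sum using (_⊎_)
open import Relation.Nullary using (¬_)
open import Data.Fin using (Fin)

open import Algebra.Bundles using (CommutativeMonoid)
import Algebra.Properties.CommutativeMonoid.Sum as CommutativeMonoidSum
import Data.Nat as ℕ
open import Data.Nat.Divisibility using (divides; n∣m*n)
open import Data.Nat.DivMod using (m*n/n≡m)
import Data.Nat.Properties as ℕ
open import Data.Integer using (ℤ; 1ℤ; _+_; _*_; -_)
open import Data.Integer.Divisibility.Signed using (∣⇒∣ᵤ; ∣n⇒∣m*n)
  renaming (_∣_ to _∣ˢ_; divides to dividesˢ)
open import Data.Integer.Properties using (+-0-commutativeMonoid; pos-*; *-cancelˡ-≡; suc-*; *-distribˡ-+)
open import Data.Integer.Tactic.RingSolver using (solve-∀)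
open import Data.Fin using (zero; suc; punchOut; _≟_; inject₁; fromℕ)
open import Data.Fin.Properties
  using (0≢1+n; punchIn-punchOut; punchOut-injective; toℕ-inject₁; toℕ-fromℕ)
  renaming (suc-injective to Fin-suc-injective)
open import Data.Product using (∃-syntax; _,_; proj₁; proj₂)
open import Data.Sum using (inj₁; inj₂)
open import Data.Vec.Functional using (Vector; removeAt)
open import Function using (_∘_)
open import Function.Definitions using (Injective)
open import Relation.Nullary.Decidable using (decidable-stable)
open import Relation.Nullary.Negation using (contradiction)
open import Relation.Binary.PropositionalEquality as ≡ using (_≡_; _≢_; cong; cong₂; subst)

module _ {c ℓ} (M : CommutativeMonoid c ℓ) where
  open CommutativeMonoid M
  open CommutativeMonoidSum M using (sum; sum-cong-≗; sum-remove)
  open import Relation.Binary.Reasoning.Setoid setoid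

  sum-reindex-injective : ∀ {n} (σ : Fin n → Fin n) → Injective _≡_ _≡_ σ →
                          (f : Vector Carrier n) → sum (f ∘ σ) ≈ sum f
  sum-reindex-injective {ℕ.zero} σ σ-injective f = refl
  sum-reindex-injective {suc n} σ σ-injective f = begin
    f (σ zero) ∙ sum (f ∘ σ ∘ suc)
      ≡⟨ cong (f (σ zero) ∙_) (sum-cong-≗ (cong f ∘ ≡.sym ∘ punchIn-punchOut ∘ σ₀≢σₛ)) ⟩
    f (σ zero) ∙ sum (removeAt f (σ zero) ∘ τ)
      ≈⟨ ∙-congˡ (sum-reindex-injective τ τ-injective (removeAt f (σ zero))) ⟩
    f (σ zero) ∙ sum (removeAt f (σ zero))
      ≈⟨ sym (sum-remove f) ⟩
    sum f ∎
    where
    σ₀≢σₛ : ∀ i → σ zero ≢ σ (suc i)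
    σ₀≢σₛ i = 0≢1+n ∘ σ-injective
    τ : Fin n → Fin n
    τ i = punchOut (σ₀≢σₛ i)
    τ-injective : Injective _≡_ _≡_ τ
    τ-injective {i} {j} = Fin-suc-injective ∘ σ-injective ∘ punchOut-injective (σ₀≢σₛ i) (σ₀≢σₛ j)

distinct⇒injective : ∀ {a} {A : Set a} {n} (f : Fin n → A) →
                     (∀ i j → i ≢ j → f i ≢ f j) → Injective _≡_ _≡_ f
distinct⇒injective f distinct {i} {j} fi≡fj = decidable-stable (i ≟ j) (λ i≢j → distinct i j i≢j fi≡fj)

open CommutativeMonoidSum +-0-commutativeMonoid
  using (sum; sum-cong-≗; ∑-distrib-+; ∑-comm; sum-init-last)

sumℤ≡sum : ∀ {k} (f : Vector ℤ k) → sumℤ f ≡ sum f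
sumℤ≡sum {ℕ.zero} f = ≡.refl
sumℤ≡sum {suc k} f = cong (_+_ (f zero)) (sumℤ≡sum (f ∘ suc))

sum-const : ∀ k (x : ℤ) → sum {k} (λ _ → x) ≡ + k * x
sum-const ℕ.zero x = ≡.refl
sum-const (suc k) x = ≡.trans (cong (_+_ x) (sum-const k x)) (≡.sym (suc-* (+ k) x))

triangular : ℕ → ℤ
triangular n = sum {n} val

triangular-double : ∀ n → + 2 * triangular n ≡ + n * + suc n
triangular-double ℕ.zero = ≡.refl
triangular-double (suc n) = begin
  + 2 * triangular (suc n)                         ≡⟨ cong (+ 2 *_) (sum-init-last (val {suc n})) ⟩
  + 2 * (sum {n} (val ∘ inject₁) + val (fromℕ n))
    ≡⟨ cong₂ (λ s l → + 2 * (s + l))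
             (sum-cong-≗ {n} {val ∘ inject₁} {val} (cong (+_ ∘ suc) ∘ toℕ-inject₁))
             (cong (+_ ∘ suc) (toℕ-fromℕ n)) ⟩
  + 2 * (triangular n + + suc n)                   ≡⟨ *-distribˡ-+ (+ 2) (triangular n) (+ suc n) ⟩
  + 2 * triangular n + + 2 * + suc n               ≡⟨ cong (λ t → t + + 2 * + suc n) (triangular-double n) ⟩
  + n * + suc n + + 2 * + suc n                    ≡⟨ step (+ n) ⟩
  + suc n * + suc (suc n)                          ∎
  where
  open ≡.≡-Reasoning
  step : ∀ x → x * (1ℤ + x) + + 2 * (1ℤ + x) ≡ (1ℤ + x) * (1ℤ + (1ℤ + x))
  step = solve-∀

sum-val-injective : ∀ {n} (σ : Fin n → Fin n) → Injective _≡_ _≡_ σ → sum (val ∘ σ) ≡ triangular n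
sum-val-injective σ σ-injective = sum-reindex-injective +-0-commutativeMonoid σ σ-injective val

sum-Δ-transversal : ∀ {m n} (H : Pos m n → Fin n) (α : Fin n → Pos m n) → IsTransversal H α →
                    sumℤ (λ a → Δ H (α a)) ≡ (1ℤ - + m) * triangular n
sum-Δ-transversal {m} {n} H α transversal = begin
  sumℤ (Δ H ∘ α)                                  ≡⟨ sumℤ≡sum (Δ H ∘ α) ⟩
  sum (Δ H ∘ α)                                   ≡⟨ cancel (sum (Δ H ∘ α)) (sum coordinates) ⟩
  sum (Δ H ∘ α) + sum coordinates - sum coordinates
    ≡⟨ cong (λ s → s - sum coordinates) (≡.sym (∑-distrib-+ (Δ H ∘ α) coordinates)) ⟩
  sum (λ a → Δ H (α a) + coordinates a) - sum coordinates
    ≡⟨ cong₂ _-_ (sum-cong-≗ (Δ+coordinates ∘ α)) coordinates-sum ⟩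
  sum (val ∘ H ∘ α) - + m * triangular n          ≡⟨ cong (λ s → s - + m * triangular n) symbols-sum ⟩
  triangular n - + m * triangular n               ≡⟨ factor (+ m) (triangular n) ⟩
  (1ℤ - + m) * triangular n                       ∎
  where
  open ≡.≡-Reasoning
  coordinates : Fin n → ℤ
  coordinates a = sumℤ (val ∘ α a)

  Δ+coordinates : ∀ i → Δ H i + sumℤ (val ∘ i) ≡ val (H i)
  Δ+coordinates i = cancel′ (val (H i)) (sumℤ (val ∘ i))
    where
    cancel′ : ∀ x y → x - y + y ≡ x
    cancel′ = solve-∀

  symbols-sum : sum (val ∘ H ∘ α) ≡ triangular n
  symbols-sum = sum-val-injective (H ∘ α)
    (distinct⇒injective (H ∘ α) (λ a b a≢b → proj₂ (transversal a b a≢b)))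

  coordinates-sum : sum coordinates ≡ + m * triangular n
  coordinates-sum = begin
    sum coordinates                         ≡⟨ sum-cong-≗ (sumℤ≡sum ∘ (val ∘_) ∘ α) ⟩
    sum (λ a → sum (λ k → val (α a k)))    ≡⟨ ∑-comm (λ a k → val (α a k)) ⟩
    sum (λ k → sum (λ a → val (α a k)))    ≡⟨ sum-cong-≗ (λ k → sum-val-injective (λ a → α a k)
                                                  (distinct⇒injective _ (λ a b a≢b → proj₁ (transversal a b a≢b) k))) ⟩
    sum {m} (λ _ → triangular n)            ≡⟨ sum-const m (triangular n) ⟩
    + m * triangular n                      ∎

  cancel : ∀ x y → x ≡ x + y - y
  cancel = solve-∀
  factor : ∀ x t → t - x * t ≡ (1ℤ - x) * t
  factor = solve-∀

even-or-odd : ∀ n → ∃[ q ] (n ≡ q ℕ.* 2 ⊎ n ≡ suc (q ℕ.* 2))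
even-or-odd ℕ.zero = 0 , inj₁ ≡.refl
even-or-odd (suc n) with even-or-odd n
... | q , inj₁ n≡2q   = q , inj₂ (cong suc n≡2q)
... | q , inj₂ n≡2q+1 = suc q , inj₁ (cong suc n≡2q+1)

¬2∣⇒odd : ∀ {n} → ¬ 2 ∣ℕ n → ∃[ q ] n ≡ suc (q ℕ.* 2)
¬2∣⇒odd {n} 2∤n with even-or-odd n
... | q , inj₁ n≡2q   = contradiction (subst (2 ∣ℕ_) (≡.sym n≡2q) (n∣m*n q)) 2∤n
... | q , inj₂ n≡2q+1 = q , n≡2q+1

¬2∣suc⇒even : ∀ {n} → ¬ 2 ∣ℕ suc n → ∃[ q ] n ≡ q ℕ.* 2
¬2∣suc⇒even {n} 2∤1+n with even-or-odd n
... | q , inj₁ n≡2q   = q , n≡2q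
... | q , inj₂ n≡2q+1 = contradiction (subst (2 ∣ℕ_) (cong suc (≡.sym n≡2q+1)) (n∣m*n (suc q))) 2∤1+n

2∣suc⇒odd : ∀ {n} → 2 ∣ℕ suc n → ∃[ q ] n ≡ suc (q ℕ.* 2)
2∣suc⇒odd (divides (suc q) 1+n≡2q+2) = q , ℕ.suc-injective 1+n≡2q+2

module _ {N T : ℤ} (2T≡N[1+N] : + 2 * T ≡ N * (1ℤ + N)) where
  open ≡.≡-Reasoning

  odd⇒∣half : ∀ Q → N ≡ 1ℤ + Q * + 2 → N ∣ˢ T
  odd⇒∣half Q ≡.refl = dividesˢ (1ℤ + Q) (*-cancelˡ-≡ (+ 2) T _ (≡.trans 2T≡N[1+N] (identity Q)))
    where
    identity : ∀ q → (1ℤ + q * + 2) * (1ℤ + (1ℤ + q * + 2)) ≡ + 2 * ((1ℤ + q) * (1ℤ + q * + 2))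
    identity = solve-∀

  odd⇒∣[1-M]*half : ∀ {M} R → M ≡ 1ℤ + R * + 2 → N ∣ˢ (1ℤ - M) * T
  odd⇒∣[1-M]*half R ≡.refl = dividesˢ (- (R * (1ℤ + N))) (begin
    (1ℤ - (1ℤ + R * + 2)) * T   ≡⟨ halve R T ⟩
    - (R * (+ 2 * T))           ≡⟨ cong (λ t → - (R * t)) 2T≡N[1+N] ⟩
    - (R * (N * (1ℤ + N)))      ≡⟨ regroup R N ⟩
    - (R * (1ℤ + N)) * N        ∎)
    where
    halve : ∀ r t → (1ℤ - (1ℤ + r * + 2)) * t ≡ - (r * (+ 2 * t))
    halve = solve-∀
    regroup : ∀ r n → - (r * (n * (1ℤ + n))) ≡ - (r * (1ℤ + n)) * n
    regroup = solve-∀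

  even⇒∣[1-M]*half-Q : ∀ {M} Q R → N ≡ Q * + 2 → M ≡ R * + 2 → N ∣ˢ (1ℤ - M) * T - Q
  even⇒∣[1-M]*half-Q Q R ≡.refl ≡.refl = dividesˢ (Q - R * (1ℤ + Q * + 2)) (begin
    (1ℤ - R * + 2) * T - Q                       ≡⟨ cong (λ t → (1ℤ - R * + 2) * t - Q) half ⟩
    (1ℤ - R * + 2) * (Q * (1ℤ + Q * + 2)) - Q   ≡⟨ identity Q R ⟩
    (Q - R * (1ℤ + Q * + 2)) * (Q * + 2)        ∎)
    where
    half : T ≡ Q * (1ℤ + Q * + 2)
    half = *-cancelˡ-≡ (+ 2) T _ (≡.trans 2T≡N[1+N] (double Q))
      where
      double : ∀ q → q * + 2 * (1ℤ + q * + 2) ≡ + 2 * (q * (1ℤ + q * + 2))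
      double = solve-∀
    identity : ∀ q r → (1ℤ - r * + 2) * (q * (1ℤ + q * + 2)) - q ≡ (q - r * (1ℤ + q * + 2)) * (q * + 2)
    identity = solve-∀

pos-even : ∀ {n} q → n ≡ q ℕ.* 2 → + n ≡ + q * + 2
pos-even q ≡.refl = pos-* q 2

pos-odd : ∀ {n} q → n ≡ suc (q ℕ.* 2) → + n ≡ 1ℤ + + q * + 2
pos-odd q ≡.refl = cong (_+_ 1ℤ) (pos-* q 2)

lemma2p4 : ∀ (m n : ℕ) → 1 ≤ m → 1 ≤ n →
    ∀ (P : Mat (suc m) n) → Λ₁ (suc m) n P →
    ∀ (H : Pos m n → Fin n) → IsH P H →
    ∀ (α : Fin n → Pos m n) → IsTransversal H α →
    ((¬ (2 ∣ℕ n) ⊎ 2 ∣ℕ suc m) → + n ∣ sumℤ (λ a → Δ H (α a)))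
    × ((2 ∣ℕ n × ¬ (2 ∣ℕ suc m)) → + n ∣ (sumℤ (λ a → Δ H (α a)) - + (n / 2)))
lemma2p4 m n _ _ _ _ H _ α transversal = n-odd-or-d-even , n-even-and-d-odd
  where
  2T≡n[1+n] : + 2 * triangular n ≡ + n * (1ℤ + + n)
  2T≡n[1+n] = triangular-double n

  sum-Δ : sumℤ (λ a → Δ H (α a)) ≡ (1ℤ - + m) * triangular n
  sum-Δ = sum-Δ-transversal H α transversal

  n-odd-or-d-even : (¬ (2 ∣ℕ n) ⊎ 2 ∣ℕ suc m) → + n ∣ sumℤ (λ a → Δ H (α a))
  n-odd-or-d-even parity = ∣⇒∣ᵤ (subst (+ n ∣ˢ_) (≡.sym sum-Δ) (divisor parity))
    where
    divisor : (¬ (2 ∣ℕ n) ⊎ 2 ∣ℕ suc m) → + n ∣ˢ (1ℤ - + m) * triangular n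
    divisor (inj₁ 2∤n) with q , n≡ ← ¬2∣⇒odd 2∤n =
      ∣n⇒∣m*n (1ℤ - + m) (odd⇒∣half 2T≡n[1+n] (+ q) (pos-odd q n≡))
    divisor (inj₂ 2∣d) with r , m≡ ← 2∣suc⇒odd 2∣d = odd⇒∣[1-M]*half 2T≡n[1+n] (+ r) (pos-odd r m≡)

  n-even-and-d-odd : (2 ∣ℕ n × ¬ (2 ∣ℕ suc m)) → + n ∣ (sumℤ (λ a → Δ H (α a)) - + (n / 2))
  n-even-and-d-odd (divides q n≡ , 2∤d) with r , m≡ ← ¬2∣suc⇒even 2∤d =
    ∣⇒∣ᵤ (subst (+ n ∣ˢ_) (cong₂ _-_ (≡.sym sum-Δ) (cong +_ (≡.sym n/2≡q)))
      (even⇒∣[1-M]*half-Q 2T≡n[1+n] (+ q) (+ r) (pos-even q n≡) (pos-even r m≡)))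
    where
    n/2≡q : n / 2 ≡ q
    n/2≡q = ≡.trans (cong (_/ 2) n≡) (m*n/n≡m q 2)
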